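{- Let $P$ be a finite nonempty connected $\Gamma$-colored poset satisfying EC and ND, let $m\ge1$, and fix a linear extension $x_1<\dots<x_p$ of $P$ with $a_t=\kappa(x_t)$. Let $I_1\supseteq\cdots\supseteq I_m$ be an $m$-flag of order ideals with corresponding $P$-partition $\psi$ and $n_t=\psi(x_t)$. Then the $m$-multiset of ideals in the leading term of $\langle a_p^{n_p},\dots,a_2^{n_2},a_1^{n_1}\rangle.\{\emptyset,\dots,\emptyset\}$ is $\{I_1,\dots,I_m\}$.
   Context: $\kappa:P\to\Gamma$ is a surjective coloring by vertices of a finite simple graph. (EC): equal-colored elements are comparable; (ND): elements in a covering relation have different colors. For an order ideal $I$ and color $a$, $X_a.I=\sum I\cup\{x\}$ over minimal elements $x$ of $P-I$ of color $a$. $m$-vectors are elements of the complex vector space with basis the $m$-multisets of order ideals; $X_a.\{I_1,\dots,I_m\}=\sum_j\{I_1,\dots,X_a.I_j,\dots,I_m\}$, $\langle a^k\rangle=\frac1{k!}X_a^k$, and $\langle b_k^{n_k},\dots,b_1^{n_1}\rangle=\langle b_k^{n_k}\rangle\circ\cdots\circ\langle b_1^{n_1}\rangle$. The $P$-partition bounded by $m$ is the order-reversing map $\psi:P\to\{0,\dots,m\}$ with $I_k=\{x:\psi(x)\ge k\}$. Gravity order on ideals: $I<J$ if $|I|>|J|$; if $|I|=|J|$, compare the elements listed in linear extension order lexicographically (earlier element means smaller). Each $m$-multiset is listed $I_1\le\cdots\le I_m$ in this order. Gravity order on $m$-multisets: $\{I_1,\dots,I_m\}<\{J_1,\dots,J_m\}$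 if $\sum|I_k|>\sum|J_k|$, or if these sums are equal and $I_\ell<J_\ell$ at the first index $\ell$ where they differ. The leading term of a nonzero $m$-vector is the term, with nonzero coefficient, whose $m$-multiset is smallest in this gravity order. -}

module Defs where

open import Data.Nat as ℕ using (ℕ; zero; suc; _≤_; _<_; _!)
open import Data.Nat.Properties using (_!≢0)
open import Data.Fin using (Fin; toℕ)
open import Data.Fin.Properties using () renaming (_≟_ to _≟F_)
open import Data.Bool using (Bool; true; false; not; _∧_; _∨_; if_then_else_)
open import Data.Bool.Properties using () renaming (_≟_ to _≟B_)
open import Data.List using (List; []; _∷_; map; concatMap; foldr; foldl; allFin; length; replicate; filter; _++_)
open import Data.Vec using (Vec; lookup; tabulate; toList)
open import Data.Vec.Properties using (≡-dec)
open import Data.Product using (_×_; _,_; Σ; ∃)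
open import Data.Sum using (_⊎_)
open import Data.Empty using (⊥)
open import Data.Integer using (+_)
open import Data.Rational using (ℚ; 0ℚ; _/_) renaming (_+_ to _+ℚ_; _*_ to _*ℚ_)
open import Relation.Nullary using (¬_; does)
open import Relation.Binary.PropositionalEquality using (_≡_; _≢_)

-- The poset P has carrier Fin p, where the (fixed) linear extension
-- x₁ < ... < x_p is x_t = the element with index t-1 (see `linExt`).

record ColoredPoset (p g : ℕ) : Set where
  field
    le     : Fin p → Fin p → Bool
    κ      : Fin p → Fin g
    refl   : ∀ x → le x x ≡ true
    antisym : ∀ x y → le x y ≡ true → le y x ≡ true → x ≡ y
    trans  : ∀ x y z → le x y ≡ true → le y z ≡ true → le x z ≡ true
    linExt : ∀ x y → le x y ≡ true → toℕ x ≤ toℕ y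

module _ {p g : ℕ} (P : ColoredPoset p g) where
  open ColoredPoset P

  _≼_ : Fin p → Fin p → Set
  x ≼ y = le x y ≡ true

  _≺_ : Fin p → Fin p → Set
  x ≺ y = x ≼ y × x ≢ y

  _⋖_ : Fin p → Fin p → Set
  x ⋖ y = x ≺ y × (∀ z → ¬ (x ≺ z × z ≺ y))

  Surjective-κ : Set
  Surjective-κ = ∀ (c : Fin g) → ∃ λ x → κ x ≡ c

  EC : Set
  EC = ∀ x y → κ x ≡ κ y → x ≼ y ⊎ y ≼ x

  ND : Set
  ND = ∀ x y → x ⋖ y → κ x ≢ κ y

  data Linked : Fin p → Fin p → Set where
    here : ∀ x → Linked x x
    step : ∀ x y z → (x ≼ y ⊎ y ≼ x) → Linked y z → Linked x z

  Connected : Set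
  Connected = ∀ x y → Linked x y

allB : ∀ {A : Set} → (A → Bool) → List A → Bool
allB f [] = true
allB f (x ∷ xs) = f x ∧ allB f xs

Ideal : ℕ → Set
Ideal p = Vec Bool p

_∈I_ : ∀ {p} → Fin p → Ideal p → Set
x ∈I I = lookup I x ≡ true

module _ {p g : ℕ} (P : ColoredPoset p g) where
  open ColoredPoset P

  IsIdeal : Ideal p → Set
  IsIdeal I = ∀ x y → le x y ≡ true → y ∈I I → x ∈I I

  isMinOutside : Ideal p → Fin g → Fin p → Bool
  isMinOutside I a x =
    not (lookup I x) ∧ does (κ x ≟F a) ∧
    allB (λ y → not (le y x) ∨ does (y ≟F x) ∨ lookup I y) (allFin p)

  addElem : Ideal p → Fin p → Ideal p
  addElem I x = tabulate (λ y → does (y ≟F x) ∨ lookup I y)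

  -- X_a . I  as a list of ideals (formal sum with coefficients 1)
  Xideal : Fin g → Ideal p → List (Ideal p)
  Xideal a I = map (addElem I) (filter (λ x → isMinOutside I a x ≟B true) (allFin p))

-- m-vectors: formal ℚ-linear combinations of m-multisets of ideals.
-- An m-multiset is represented by a list of ideals (of length m), read
-- up to reordering; an m-vector by a finite list of (coefficient, term).

MVec : ℕ → Set
MVec p = List (ℚ × List (Ideal p))

module _ {p g : ℕ} (P : ColoredPoset p g) where

  Xmulti : Fin g → List (Ideal p) → List (List (Ideal p))
  Xmulti a []      = []
  Xmulti a (I ∷ L) = map (_∷ L) (Xideal P a I) ++ map (I ∷_) (Xmulti a L)

  Xvec : Fin g → MVec p → MVec p
  Xvec a v = concatMap (λ { (c , L) → map (c ,_) (Xmulti a L) }) v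

  Xpow : Fin g → ℕ → MVec p → MVec p
  Xpow a zero    v = v
  Xpow a (suc k) v = Xvec a (Xpow a k v)

  scale : ℚ → MVec p → MVec p
  scale q = map (λ { (c , L) → (q *ℚ c , L) })

  divPow : Fin g → ℕ → MVec p → MVec p
  divPow a k v = scale ((+ 1 / (k !)) {{k !≢0}}) (Xpow a k v)

  -- ⟨a_p^{n_p}, ..., a_1^{n_1}⟩ . v, where a_t = κ(x_t):
  -- ⟨a_1^{n_1}⟩ is applied first.
  applyWord : (Fin p → ℕ) → MVec p → MVec p
  applyWord n v = foldl (λ w x → divPow (ColoredPoset.κ P x) (n x) w) v (allFin p)

emptyMulti : (p m : ℕ) → List (Ideal p)
emptyMulti p m = replicate m (Data.Vec.replicate p false)

count : ∀ {p} → Ideal p → List (Ideal p) → ℕ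
count J [] = 0
count J (I ∷ L) = if does (≡-dec _≟B_ J I) then suc (count J L) else count J L

sameMultiset : ∀ {p} → List (Ideal p) → List (Ideal p) → Bool
sameMultiset L M =
  does (length L ℕ.≟ length M) ∧
  allB (λ J → does (count J L ℕ.≟ count J M)) (L ++ M)

coeff : ∀ {p} → MVec p → List (Ideal p) → ℚ
coeff [] M = 0ℚ
coeff ((c , L) ∷ v) M = if sameMultiset L M then c +ℚ coeff v M else coeff v M

size : ∀ {p} → Ideal p → ℕ
size I = length (filter (λ b → b ≟B true) (toList I))

elems : ∀ {p} → Ideal p → List ℕ
elems {p} I = map toℕ (filter (λ x → lookup I x ≟B true) (allFin p))

Lex : ∀ {A : Set} → (A → A → Set) → List A → List A → Set
Lex R []       _        = ⊥
Lex R (_ ∷ _)  []       = ⊥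
Lex R (x ∷ xs) (y ∷ ys) = R x y ⊎ (x ≡ y × Lex R xs ys)

_<G_ : ∀ {p} → Ideal p → Ideal p → Set
I <G J = size J < size I ⊎ (size I ≡ size J × Lex _<_ (elems I) (elems J))

data SortedG {p} : List (Ideal p) → Set where
  []  : SortedG []
  [-] : ∀ I → SortedG (I ∷ [])
  _∷_ : ∀ {I J L} → (I <G J ⊎ I ≡ J) → SortedG (J ∷ L) → SortedG (I ∷ J ∷ L)

totalSize : ∀ {p} → List (Ideal p) → ℕ
totalSize = foldr (λ I s → size I ℕ.+ s) 0

_<GM_ : ∀ {p} → List (Ideal p) → List (Ideal p) → Set
L <GM M = totalSize M < totalSize L ⊎ (totalSize L ≡ totalSize M × Lex _<G_ L M)

IsLeadingMultiset : ∀ {p} → MVec p → List (Ideal p) → Set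
IsLeadingMultiset v L =
  coeff v L ≢ 0ℚ ×
  (∀ L' M → sameMultiset L L' ≡ true → SortedG L' → SortedG M →
     coeff v M ≢ 0ℚ → L' ≡ M ⊎ L' <GM M)

{-# OPTIONS --safe #-}
-- Every term of ⟨a_p^{n_p},…,a_1^{n_1}⟩.{∅,…,∅} has a positive coefficient and records a way of
-- handing, for t = 1,…,p in turn, n_t copies of x_t to the m slots, each copy entering its slot as a
-- minimal element of colour a_t outside it. By EC and ND, X_a X_a kills every ideal, so during the
-- t-th block a slot takes at most one element, and that element lies below x_t; hence every slot stays
-- inside I_1 = {ψ ≥ 1}. Giving x_t to the first n_t slots produces the flag itself. All terms have the
-- same total size, and in a term listed in gravity order the first slot is either strictly smaller
-- than I_1 or equal to it; in the latter case it took each x_t with n_t ≥ 1 exactly once, so the other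
-- slots form a term for ψ − 1 with m − 1 slots, and induction on m shows the flag is gravity-least.
module Submission where

open import Defs
open import Data.Bool using (Bool; true; false; not; _∧_; _∨_)
open import Data.Bool.Properties using (not-injective; ¬-not) renaming (_≟_ to _≟B_)
open import Data.Empty using (⊥; ⊥-elim)
open import Data.Fin as F using (Fin; toℕ)
open import Data.Fin.Properties using (toℕ-injective; suc-injective; ¬∀⟶∃¬) renaming (_≟_ to _≟F_)
open import Data.List using (List; []; _∷_; _++_; _∷ʳ_; [_]; length; replicate; map; allFin; foldl; concatMap; tabulate)
open import Data.List.Properties using (++-assoc; ++-identityʳ; concatMap-++; length-replicate; map-tabulate)
open import Data.List.Membership.Propositional using (_∈_)
open import Data.List.Membership.Propositional.Properties
  using (∈-++⁻; ∈-++⁺ˡ; ∈-++⁺ʳ; ∈-map⁻; ∈-map⁺; ∈-filter⁻; ∈-filter⁺; ∈-allFin; ∈-∃++;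
         ∈-tabulate⁻)
open import Data.List.Relation.Unary.All as All using (All; []; _∷_)
open import Data.List.Relation.Unary.All.Properties using (replicate⁺)
open import Data.List.Relation.Unary.AllPairs using (AllPairs; []; _∷_)
open import Data.List.Relation.Unary.AllPairs.Properties using (tabulate⁺-<)
open import Data.List.Relation.Unary.Any using (here; there)
open import Data.List.Relation.Binary.Permutation.Propositional using (_↭_; prep; swap; ↭-sym; ↭-trans)
import Data.List.Relation.Binary.Permutation.Propositional as Perm
open import Data.List.Relation.Binary.Permutation.Propositional.Properties
  using (↭-length; ↭-empty-inv; ∈-resp-↭; All-resp-↭; shift; drop-∷)
open import Data.Integer using () renaming (+_ to ℤ+)
open import Data.Nat as ℕ using (ℕ; zero; suc; pred; _+_; _≤_; _<_; z≤n; s≤s; _!)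
open import Data.Nat.Properties as ℕP using (_!≢0)
open import Data.Product using (_×_; _,_; proj₁; proj₂; ∃; ∃₂)
open import Data.Rational using (ℚ; 0ℚ; 1ℚ; _/_; Positive; NonNegative) renaming (_*_ to _*ℚ_; _+_ to _+ℚ_)
open import Data.Rational.Properties
  using (pos⇒nonNeg; pos+nonNeg⇒pos; nonNeg+pos⇒pos; pos*pos⇒pos; normalize-pos)
open import Data.Sum using (_⊎_; inj₁; inj₂)
open import Data.Unit using (⊤; tt)
open import Data.Vec as V using (Vec; lookup)
open import Data.Vec.Properties using (tabulate∘lookup; tabulate-cong; lookup∘tabulate; lookup-replicate; ≡-dec)
open import Function using (_∘_; id; flip; _⇔_; Equivalence; mk⇔)
open import Relation.Nullary using (¬_; Dec; yes; no; does)
open import Relation.Nullary.Decidable using (dec-true; dec-false; ¬?; _×-dec_; decidable-stable)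
open import Relation.Binary.PropositionalEquality using (_≡_; _≢_; refl; sym; trans; cong; cong₂; subst)

∧-trueˡ : ∀ {a b} → a ∧ b ≡ true → a ≡ true
∧-trueˡ {true} _ = refl

∧-trueʳ : ∀ {a b} → a ∧ b ≡ true → b ≡ true
∧-trueʳ {true} e = e

∧-true : ∀ {a b} → a ≡ true → b ≡ true → a ∧ b ≡ true
∧-true refl refl = refl

∨-true⁻ : ∀ {a b} → a ∨ b ≡ true → a ≡ true ⊎ b ≡ true
∨-true⁻ {true} _ = inj₁ refl
∨-true⁻ {false} e = inj₂ e

∨-trueʳ : ∀ a {b} → b ≡ true → a ∨ b ≡ true
∨-trueʳ true _ = refl
∨-trueʳ false e = e

≡true⇒≢false : ∀ {a} → a ≡ true → a ≢ false
≡true⇒≢false refl ()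

does⇒ : ∀ {A : Set} (d : Dec A) → does d ≡ true → A
does⇒ (yes a) _ = a
does⇒ (no _) ()

allB-sound : ∀ {A : Set} (f : A → Bool) xs → allB f xs ≡ true → ∀ {x} → x ∈ xs → f x ≡ true
allB-sound f (y ∷ xs) e (here refl) = ∧-trueˡ e
allB-sound f (y ∷ xs) e (there x∈xs) = allB-sound f xs (∧-trueʳ {f y} e) x∈xs

allB-complete : ∀ {A : Set} (f : A → Bool) xs → (∀ {x} → x ∈ xs → f x ≡ true) → allB f xs ≡ true
allB-complete f [] h = refl
allB-complete f (y ∷ xs) h = ∧-true (h (here refl)) (allB-complete f xs (h ∘ there))

_⊆I_ : ∀ {p} → Ideal p → Ideal p → Set
J ⊆I K = ∀ y → y ∈I J → y ∈I K

lookup-ext : ∀ {n} (v w : Vec Bool n) → (∀ i → lookup v i ≡ lookup w i) → v ≡ w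
lookup-ext v w h = trans (sym (tabulate∘lookup v)) (trans (tabulate-cong h) (tabulate∘lookup w))

size-mono : ∀ {n} (v w : Vec Bool n) → v ⊆I w → size v ≤ size w
size-mono V.[] V.[] h = z≤n
size-mono (true V.∷ v) (true V.∷ w) h = s≤s (size-mono v w (h ∘ F.suc))
size-mono (true V.∷ v) (false V.∷ w) h with () ← h F.zero refl
size-mono (false V.∷ v) (true V.∷ w) h = ℕP.m≤n⇒m≤1+n (size-mono v w (h ∘ F.suc))
size-mono (false V.∷ v) (false V.∷ w) h = size-mono v w (h ∘ F.suc)

⊆∧size≥⇒≡ : ∀ {n} (v w : Vec Bool n) → v ⊆I w → size w ≤ size v → v ≡ w
⊆∧size≥⇒≡ V.[] V.[] h le = refl
⊆∧size≥⇒≡ (true V.∷ v) (true V.∷ w) h (s≤s le) = cong (true V.∷_) (⊆∧size≥⇒≡ v w (h ∘ F.suc) le)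
⊆∧size≥⇒≡ (true V.∷ v) (false V.∷ w) h le with () ← h F.zero refl
⊆∧size≥⇒≡ (false V.∷ v) (true V.∷ w) h le =
  ⊥-elim (ℕP.<-irrefl refl (ℕP.≤-trans le (size-mono v w (h ∘ F.suc))))
⊆∧size≥⇒≡ (false V.∷ v) (false V.∷ w) h le = cong (false V.∷_) (⊆∧size≥⇒≡ v w (h ∘ F.suc) le)

⊂⇒size< : ∀ {n} (v w : Vec Bool n) → v ⊆I w → v ≢ w → size v < size w
⊂⇒size< v w v⊆w v≢w =
  ℕP.≤∧≢⇒< (size-mono v w v⊆w) (λ eq → v≢w (⊆∧size≥⇒≡ v w v⊆w (ℕP.≤-reflexive (sym eq))))

size-insert : ∀ {n} (v w : Vec Bool n) y → lookup v y ≡ false → lookup w y ≡ true →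
  (∀ z → z ≢ y → lookup w z ≡ lookup v z) → size w ≡ suc (size v)
size-insert (_ V.∷ v) (_ V.∷ w) F.zero refl refl h =
  cong (suc ∘ size) (lookup-ext w v (λ i → h (F.suc i) λ ()))
size-insert (a V.∷ v) (b V.∷ w) (F.suc y) v∌y w∋y h with h F.zero (λ ())
... | refl with a
...   | true  = cong suc (size-insert v w y v∌y w∋y (λ z z≢y → h (F.suc z) (z≢y ∘ suc-injective)))
...   | false = size-insert v w y v∌y w∋y (λ z z≢y → h (F.suc z) (z≢y ∘ suc-injective))

data StepAt {A : Set} (R : A → A → Set) : List A → List A → Set where
  here  : ∀ {x y xs} → R x y → StepAt R (x ∷ xs) (y ∷ xs)
  there : ∀ {x xs ys} → StepAt R xs ys → StepAt R (x ∷ xs) (x ∷ ys)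

module _ {A : Set} where

  StepAt-flip : ∀ {R : A → A → Set} {xs ys} → StepAt R xs ys → StepAt (flip R) ys xs
  StepAt-flip (here r) = here r
  StepAt-flip (there s) = there (StepAt-flip s)

  StepAt-length : ∀ {R : A → A → Set} {xs ys} → StepAt R xs ys → length ys ≡ length xs
  StepAt-length (here _) = refl
  StepAt-length (there s) = cong suc (StepAt-length s)

  StepAt-↭ : ∀ {R : A → A → Set} {xs ys xs'} → StepAt R xs ys → xs ↭ xs' →
    ∃ λ ys' → StepAt R xs' ys' × ys ↭ ys'
  StepAt-↭ s Perm.refl = _ , s , Perm.refl
  StepAt-↭ (here r) (prep x q) = _ , here r , prep _ q
  StepAt-↭ (there s) (prep x q) with ys' , s' , q' ← StepAt-↭ s q = _ , there s' , prep x q'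
  StepAt-↭ (here r) (swap x y q) = _ , there (here r) , swap _ y q
  StepAt-↭ (there (here r)) (swap x y q) = _ , here r , swap x _ q
  StepAt-↭ (there (there s)) (swap x y q) with ys' , s' , q' ← StepAt-↭ s q = _ , there (there s') , swap x y q'
  StepAt-↭ s (Perm.trans q₁ q₂) with StepAt-↭ s q₁
  ... | _ , s₁ , r₁ with StepAt-↭ s₁ q₂
  ...   | _ , s₂ , r₂ = _ , s₂ , Perm.trans r₁ r₂

  ↭-StepAt : ∀ {R : A → A → Set} {xs ys ys'} → StepAt R xs ys → ys ↭ ys' →
    ∃ λ xs' → StepAt R xs' ys' × xs ↭ xs'
  ↭-StepAt s q with xs' , s' , q' ← StepAt-↭ (StepAt-flip s) q = xs' , StepAt-flip s' , q'

data Run {A X : Set} (R : X → A → A → Set) : List X → List A → List A → Set where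
  []  : ∀ {xs} → Run R [] xs xs
  _∷_ : ∀ {a w xs ys zs} → StepAt (R a) xs ys → Run R w ys zs → Run R (a ∷ w) xs zs

module _ {A X : Set} {R : X → A → A → Set} where

  Run-++ : ∀ {u w xs ys zs} → Run R u xs ys → Run R w ys zs → Run R (u ++ w) xs zs
  Run-++ [] r = r
  Run-++ (s ∷ r₁) r₂ = s ∷ Run-++ r₁ r₂

  Run-++⁻ : ∀ u {w xs zs} → Run R (u ++ w) xs zs → ∃ λ ys → Run R u xs ys × Run R w ys zs
  Run-++⁻ [] r = _ , [] , r
  Run-++⁻ (a ∷ u) (s ∷ r) with ys , r₁ , r₂ ← Run-++⁻ u r = ys , s ∷ r₁ , r₂

  Run-length : ∀ {w xs ys} → Run R w xs ys → length ys ≡ length xs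
  Run-length [] = refl
  Run-length (s ∷ r) = trans (Run-length r) (StepAt-length s)

  Run-there : ∀ {w x xs ys} → Run R w xs ys → Run R w (x ∷ xs) (x ∷ ys)
  Run-there [] = []
  Run-there (s ∷ r) = there s ∷ Run-there r

  ↭-Run : ∀ {w xs ys ys'} → Run R w xs ys → ys ↭ ys' → ∃ λ xs' → xs ↭ xs' × Run R w xs' ys'
  ↭-Run [] q = _ , q , []
  ↭-Run (s ∷ r) q with ↭-Run r q
  ... | _ , q₁ , r₁ with ↭-StepAt s q₁
  ...   | xs' , s' , q₂ = xs' , q₂ , s' ∷ r₁

↭-replicate⁻ : ∀ {A : Set} m {a : A} {xs} → replicate m a ↭ xs → xs ≡ replicate m a
↭-replicate⁻ m {a} {xs} q =
  trans (all≡ xs (All-resp-↭ q (replicate⁺ m refl)))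
        (cong (λ n → replicate n a) (trans (sym (↭-length q)) (length-replicate m)))
  where
  all≡ : ∀ ys → All (_≡ a) ys → ys ≡ replicate (length ys) a
  all≡ [] [] = refl
  all≡ (y ∷ ys) (refl ∷ as) = cong (y ∷_) (all≡ ys as)

count-middle : ∀ {p} (J : Ideal p) xs y ys → count J (xs ++ y ∷ ys) ≡ count J (y ∷ xs ++ ys)
count-middle J [] y ys = refl
count-middle J (x ∷ xs) y ys with does (≡-dec _≟B_ J x) | does (≡-dec _≟B_ J y) | count-middle J xs y ys
... | true  | true  | e = cong suc e
... | true  | false | e = cong suc e
... | false | true  | e = e
... | false | false | e = e

count-self : ∀ {p} (J : Ideal p) L → count J (J ∷ L) ≡ suc (count J L)
count-self J L rewrite dec-true (≡-dec _≟B_ J J) refl = refl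

count>0⇒∈ : ∀ {p} (J : Ideal p) L → 0 < count J L → J ∈ L
count>0⇒∈ J (K ∷ L) pos with ≡-dec _≟B_ J K
... | yes refl = here refl
... | no _ = there (count>0⇒∈ J L pos)

↭-fromCount : ∀ {p} (L M : List (Ideal p)) → (∀ J → J ∈ L ++ M → count J L ≡ count J M) → L ↭ M
↭-fromCount [] [] h = Perm.refl
↭-fromCount [] (K ∷ M) h with () ← trans (h K (here refl)) (count-self K M)
↭-fromCount (K ∷ L) M h
  with A , B , refl ← ∈-∃++ (count>0⇒∈ K M (subst (0 <_) (trans (sym (count-self K L)) (h K (here refl)))
                                                      (s≤s z≤n)))
  = ↭-trans (prep K (↭-fromCount L (A ++ B) h′)) (↭-sym (shift K A B))
  where
  h′ : ∀ J → J ∈ L ++ A ++ B → count J L ≡ count J (A ++ B)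
  h′ J J∈ = cancel (trans (h J (there J∈′)) (count-middle J A K B))
    where
    J∈′ : J ∈ L ++ A ++ K ∷ B
    J∈′ with ∈-++⁻ L J∈
    ... | inj₁ J∈L = ∈-++⁺ˡ J∈L
    ... | inj₂ J∈AB with ∈-++⁻ A J∈AB
    ...   | inj₁ J∈A = ∈-++⁺ʳ L (∈-++⁺ˡ J∈A)
    ...   | inj₂ J∈B = ∈-++⁺ʳ L (∈-++⁺ʳ A (there J∈B))
    cancel : count J (K ∷ L) ≡ count J (K ∷ A ++ B) → count J L ≡ count J (A ++ B)
    cancel e with does (≡-dec _≟B_ J K)
    ... | true = ℕP.suc-injective e
    ... | false = e

sameMultiset⇒↭ : ∀ {p} (L M : List (Ideal p)) → sameMultiset L M ≡ true → L ↭ M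
sameMultiset⇒↭ L M e = ↭-fromCount L M (λ J J∈ →
  does⇒ (count J L ℕ.≟ count J M) (allB-sound _ (L ++ M) (∧-trueʳ {does (length L ℕ.≟ length M)} e) J∈))

sameMultiset-refl : ∀ {p} (L : List (Ideal p)) → sameMultiset L L ≡ true
sameMultiset-refl L = ∧-true (dec-true (length L ℕ.≟ length L) refl)
  (allB-complete _ (L ++ L) (λ {J} _ → dec-true (count J L ℕ.≟ count J L) refl))

AllPositive : ∀ {p} → MVec p → Set
AllPositive v = ∀ {c L} → (c , L) ∈ v → Positive c

coeff-nonNeg : ∀ {p} (v : MVec p) M → AllPositive v → NonNegative (coeff v M)
coeff-nonNeg [] M pos = _
coeff-nonNeg ((c , L) ∷ v) M pos with sameMultiset L M
... | true  = pos⇒nonNeg (c +ℚ coeff v M)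
                {{pos+nonNeg⇒pos c {{pos (here refl)}} (coeff v M) {{coeff-nonNeg v M (pos ∘ there)}}}}
... | false = coeff-nonNeg v M (pos ∘ there)

coeff-pos : ∀ {p} (v : MVec p) M {c L} → AllPositive v → (c , L) ∈ v → sameMultiset L M ≡ true →
  Positive (coeff v M)
coeff-pos ((c , L) ∷ v) M pos (here refl) L≈M rewrite L≈M =
  pos+nonNeg⇒pos c {{pos (here refl)}} (coeff v M) {{coeff-nonNeg v M (pos ∘ there)}}
coeff-pos ((c₀ , L₀) ∷ v) M pos (there t∈v) L≈M with sameMultiset L₀ M
... | true  = nonNeg+pos⇒pos c₀ {{pos⇒nonNeg c₀ {{pos (here refl)}}}}
                               (coeff v M) {{coeff-pos v M (pos ∘ there) t∈v L≈M}}
... | false = coeff-pos v M (pos ∘ there) t∈v L≈M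

coeff≢0⇒term : ∀ {p} (v : MVec p) M → coeff v M ≢ 0ℚ →
  ∃₂ λ c L → (c , L) ∈ v × sameMultiset L M ≡ true
coeff≢0⇒term [] M c≢0 = ⊥-elim (c≢0 refl)
coeff≢0⇒term ((c , L) ∷ v) M c≢0 with sameMultiset L M in L≈M
... | true  = c , L , here refl , L≈M
... | false with c′ , L′ , t∈v , L′≈M ← coeff≢0⇒term v M c≢0 = c′ , L′ , there t∈v , L′≈M

positive⇒≢0 : ∀ q → Positive q → q ≢ 0ℚ
positive⇒≢0 q () refl

IsLeadingMultiset-intro : ∀ {p} (v : MVec p) {c L} → AllPositive v → (c , L) ∈ v →
  (∀ L′ M → L ↭ L′ → SortedG L′ → SortedG M → ∀ {c′ K} → (c′ , K) ∈ v → K ↭ M →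
     L′ ≡ M ⊎ L′ <GM M) →
  IsLeadingMultiset v L
IsLeadingMultiset-intro v {L = L} pos t∈v minimal =
  positive⇒≢0 _ (coeff-pos v L pos t∈v (sameMultiset-refl L)) ,
  λ L′ M L≈L′ sL′ sM coeff≢0 → 
    let _ , K , t′∈v , K≈M = coeff≢0⇒term v M coeff≢0
    in minimal L′ M (sameMultiset⇒↭ L L′ L≈L′) sL′ sM t′∈v (sameMultiset⇒↭ K M K≈M)

record PrefixBefore {p} (seen : List (Fin p)) (x : Fin p) : Set where
  field
    below    : ∀ {y} → y ∈ seen → toℕ y < toℕ x
    complete : ∀ {y} → toℕ y < toℕ x → y ∈ seen

AllPairs-++-∷ : ∀ {A : Set} {R : A → A → Set} xs {y ys} → AllPairs R (xs ++ y ∷ ys) →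
  All (λ x → R x y) xs × All (R y) ys
AllPairs-++-∷ [] (Ry ∷ _) = [] , Ry
AllPairs-++-∷ (x ∷ xs) (Rx ∷ Rxs) with Rxsy , Ry ← AllPairs-++-∷ xs Rxs =
  All.lookup Rx (∈-++⁺ʳ xs (here refl)) ∷ Rxsy , Ry

prefixBefore : ∀ {p} seen {x : Fin p} rest → seen ++ x ∷ rest ≡ allFin p → PrefixBefore seen x
prefixBefore {p} seen {x} rest eq = record { below = All.lookup (proj₁ split) ; complete = complete }
  where
  split : All (λ y → toℕ y < toℕ x) seen × All (λ z → toℕ x < toℕ z) rest
  split = AllPairs-++-∷ seen (subst (AllPairs F._<_) (sym eq) (tabulate⁺-< id))
  complete : ∀ {y} → toℕ y < toℕ x → y ∈ seen
  complete {y} y<x with ∈-++⁻ seen (subst (y ∈_) (sym eq) (∈-allFin y))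
  ... | inj₁ y∈seen = y∈seen
  ... | inj₂ (here refl) = ⊥-elim (ℕP.<-irrefl refl y<x)
  ... | inj₂ (there y∈rest) = ⊥-elim (ℕP.<-asym y<x (All.lookup (proj₂ split) y∈rest))

allFin-∷ʳ-induction : ∀ {p} (Q : List (Fin p) → Set) → Q [] →
  (∀ seen x → PrefixBefore seen x → Q seen → Q (seen ∷ʳ x)) → Q (allFin p)
allFin-∷ʳ-induction {p} Q q[] q∷ʳ = go [] (allFin p) refl q[]
  where
  go : ∀ seen rest → seen ++ rest ≡ allFin p → Q seen → Q (allFin p)
  go seen [] eq q = subst Q (trans (sym (++-identityʳ seen)) eq) q
  go seen (x ∷ rest) eq q =
    go (seen ∷ʳ x) rest (trans (++-assoc seen [ x ] rest) eq) (q∷ʳ seen x (prefixBefore seen rest eq) q)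

prefix-∌ : ∀ {p} {seen : List (Fin p)} {x} → PrefixBefore seen x → ¬ (x ∈ seen)
prefix-∌ pre x∈seen = ℕP.<-irrefl refl (PrefixBefore.below pre x∈seen)

∈-∷ʳ⁻ : ∀ {A : Set} xs {x y : A} → y ∈ xs ∷ʳ x → y ∈ xs ⊎ y ≡ x
∈-∷ʳ⁻ xs y∈ with ∈-++⁻ xs y∈
... | inj₁ y∈xs = inj₁ y∈xs
... | inj₂ (here y≡x) = inj₂ y≡x

∈-∷ʳ-self : ∀ {A : Set} xs (x : A) → x ∈ xs ∷ʳ x
∈-∷ʳ-self xs x = ∈-++⁺ʳ xs (here refl)

word : ∀ {p} → (Fin p → ℕ) → List (Fin p) → List (Fin p)
word ψ = concatMap (λ x → replicate (ψ x) x)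

word-∷ʳ : ∀ {p} (ψ : Fin p → ℕ) seen x → word ψ (seen ∷ʳ x) ≡ word ψ seen ++ replicate (ψ x) x
word-∷ʳ ψ seen x = trans (concatMap-++ _ seen [ x ]) (cong (word ψ seen ++_) (++-identityʳ _))

∅ : ∀ {p} → Ideal p
∅ {p} = V.replicate p false

∉∅ : ∀ {p} (y : Fin p) → ¬ (y ∈I ∅)
∉∅ y y∈∅ = ≡true⇒≢false y∈∅ (lookup-replicate y false)

record Support {p} (ψ : Fin p → ℕ) (seen : List (Fin p)) (y : Fin p) : Set where
  constructor support
  field
    ∈seen    : y ∈ seen
    positive : 1 ≤ ψ y

Support-∷ʳ : ∀ {p} {ψ : Fin p → ℕ} {seen x y} → Support ψ seen y → Support ψ (seen ∷ʳ x) y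
Support-∷ʳ (support y∈ ψy≥1) = support (∈-++⁺ˡ y∈) ψy≥1

record IsLevel {p} (ψ : Fin p → ℕ) (seen : List (Fin p)) (J : Ideal p) : Set where
  constructor level
  field
    ⊆Support : ∀ y → y ∈I J → Support ψ seen y
    Support⊆ : ∀ y → Support ψ seen y → y ∈I J

-- The k-th entry (from 0) of a flag is the level {y ∈ seen : ψ y > k}, i.e. the paper's I_{k+1}.
IsFlag : ∀ {p} → (Fin p → ℕ) → List (Fin p) → List (Ideal p) → Set
IsFlag ψ seen [] = ⊤
IsFlag ψ seen (J ∷ L) = IsLevel ψ seen J × IsFlag (pred ∘ ψ) seen L

IsLevel-∷ʳ-zero : ∀ {p} {ψ : Fin p → ℕ} {seen x J} → ψ x ≡ 0 → IsLevel ψ seen J → IsLevel ψ (seen ∷ʳ x) J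
IsLevel-∷ʳ-zero {ψ = ψ} {seen} {x} {J} ψx≡0 (level J⊆ ⊆J) = level (λ y → Support-∷ʳ ∘ J⊆ y) ⊆J′
  where
  ⊆J′ : ∀ y → Support ψ (seen ∷ʳ x) y → y ∈I J
  ⊆J′ y (support y∈ ψy≥1) with ∈-∷ʳ⁻ seen y∈
  ... | inj₁ y∈seen = ⊆J y (support y∈seen ψy≥1)
  ... | inj₂ refl = ⊥-elim (ℕP.<-irrefl (sym ψx≡0) ψy≥1)

IsFlag-∷ʳ-zero : ∀ {p} {ψ : Fin p → ℕ} {seen x} L → ψ x ≡ 0 → IsFlag ψ seen L → IsFlag ψ (seen ∷ʳ x) L
IsFlag-∷ʳ-zero [] ψx≡0 _ = tt
IsFlag-∷ʳ-zero (J ∷ L) ψx≡0 (J-level , L-flag) =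
  IsLevel-∷ʳ-zero ψx≡0 J-level , IsFlag-∷ʳ-zero L (cong pred ψx≡0) L-flag

IsLevel-∷ʳ⁻ : ∀ {p} {ψ : Fin p → ℕ} {seen x J J₀} → PrefixBefore seen x → IsLevel ψ (seen ∷ʳ x) J →
  (∀ z → z ∈I J₀ → Support ψ seen z) → (∀ z → z ∈I J → z ≡ x ⊎ z ∈I J₀) → IsLevel ψ seen J₀
IsLevel-∷ʳ⁻ {ψ = ψ} {seen} {J₀ = J₀} pre (level _ ⊆J) J₀⊆ J⊆ = level J₀⊆ ⊆J₀
  where
  ⊆J₀ : ∀ z → Support ψ seen z → z ∈I J₀
  ⊆J₀ z z-supp with J⊆ z (⊆J z (Support-∷ʳ z-supp))
  ... | inj₁ refl = ⊥-elim (prefix-∌ pre (Support.∈seen z-supp))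
  ... | inj₂ z∈J₀ = z∈J₀

IsFlag-empty : ∀ {p} m (ψ : Fin p → ℕ) → IsFlag ψ [] (emptyMulti p m)
IsFlag-empty zero ψ = tt
IsFlag-empty (suc m) ψ =
  level (λ y y∈∅ → ⊥-elim (∉∅ y y∈∅)) (λ { y (support () _) }) , IsFlag-empty m (pred ∘ ψ)

record FlagOf {p m} (I : Fin m → Ideal p) (ψ : Fin p → ℕ) : Set where
  constructor flagOf
  field ∈⇔ : ∀ k x → (x ∈I I k) ⇔ (suc (toℕ k) ≤ ψ x)

module _ {p m} {I : Fin (suc m) → Ideal p} {ψ : Fin p → ℕ} (flag : FlagOf I ψ) where
  open FlagOf flag

  FlagOf-tail : FlagOf (I ∘ F.suc) (pred ∘ ψ)
  FlagOf-tail = flagOf λ k x → mk⇔ (ℕP.pred-mono-≤ ∘ Equivalence.to (∈⇔ (F.suc k) x))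
                                   (Equivalence.from (∈⇔ (F.suc k) x) ∘ ≤pred⇒< (ψ x))
    where
    ≤pred⇒< : ∀ {k} n → suc k ≤ pred n → suc (suc k) ≤ n
    ≤pred⇒< (suc n) k<n = s≤s k<n

  FlagOf-⊆head : ∀ k → I k ⊆I I F.zero
  FlagOf-⊆head k y y∈ = Equivalence.from (∈⇔ F.zero y) (ℕP.≤-trans (s≤s z≤n) (Equivalence.to (∈⇔ k y) y∈))

  IsLevel-head : IsLevel ψ (allFin p) (I F.zero)
  IsLevel-head = level (λ y y∈ → support (∈-allFin y) (Equivalence.to (∈⇔ F.zero y) y∈))
                       (λ y y-supp → Equivalence.from (∈⇔ F.zero y) (Support.positive y-supp))

IsLevel-unique : ∀ {p} {ψ : Fin p → ℕ} {seen J K} → IsLevel ψ seen J → IsLevel ψ seen K → J ≡ K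
IsLevel-unique {J = J} {K} (level J⊆ ⊆J) (level K⊆ ⊆K) =
  lookup-ext J K λ y → bool-ext (⊆K y ∘ J⊆ y) (⊆J y ∘ K⊆ y)
  where
  bool-ext : ∀ {a b : Bool} → (a ≡ true → b ≡ true) → (b ≡ true → a ≡ true) → a ≡ b
  bool-ext {true}  a⇒b _ = sym (a⇒b refl)
  bool-ext {false} {false} _ _ = refl
  bool-ext {false} {true} _ b⇒a = b⇒a refl

IsFlag⇒≡tabulate : ∀ {p m} {I : Fin m → Ideal p} {ψ L} → FlagOf I ψ → IsFlag ψ (allFin p) L →
  length L ≡ m → L ≡ tabulate I
IsFlag⇒≡tabulate {m = zero} {L = []} flag _ _ = refl
IsFlag⇒≡tabulate {m = suc m} {L = J ∷ L} flag (J-level , L-flag) refl =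
  cong₂ _∷_ (IsLevel-unique J-level (IsLevel-head flag)) (IsFlag⇒≡tabulate (FlagOf-tail flag) L-flag refl)

SortedG-tail : ∀ {p} {J : Ideal p} {L} → SortedG (J ∷ L) → SortedG L
SortedG-tail ([-] _) = []
SortedG-tail (_ ∷ s) = s

SortedG-head-max : ∀ {p} {J : Ideal p} {L K} → SortedG (J ∷ L) → K ∈ J ∷ L → size K ≤ size J
SortedG-head-max s (here refl) = ℕP.≤-refl
SortedG-head-max (J≤ ∷ s) (there K∈) = ℕP.≤-trans (SortedG-head-max s K∈) (size-anti J≤)
  where
  size-anti : ∀ {p} {J K : Ideal p} → J <G K ⊎ J ≡ K → size K ≤ size J
  size-anti (inj₁ (inj₁ lt)) = ℕP.<⇒≤ lt
  size-anti (inj₁ (inj₂ (eq , _))) = ℕP.≤-reflexive (sym eq)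
  size-anti (inj₂ refl) = ℕP.≤-refl

SortedG-flag-unique : ∀ {p m} {I : Fin m → Ideal p} {ψ L} → FlagOf I ψ → SortedG L → L ↭ tabulate I →
  L ≡ tabulate I
SortedG-flag-unique {m = zero} flag sL q = ↭-empty-inv q
SortedG-flag-unique {m = suc m} {I} {L = []} flag sL q with () ← ↭-length q
SortedG-flag-unique {m = suc m} {I} {L = H ∷ L} flag sL q = cong₂ _∷_ H≡I₀ tail≡
  where
  H⊆I₀ : H ⊆I I F.zero
  H⊆I₀ with k , refl ← ∈-tabulate⁻ {f = I} (∈-resp-↭ q (here refl)) = FlagOf-⊆head flag k
  H≡I₀ : H ≡ I F.zero
  H≡I₀ = ⊆∧size≥⇒≡ H (I F.zero) H⊆I₀ (SortedG-head-max sL (∈-resp-↭ (↭-sym q) (here refl)))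
  tail≡ : L ≡ tabulate (I ∘ F.suc)
  tail≡ = SortedG-flag-unique (FlagOf-tail flag) (SortedG-tail sL) (drop-∷ (subst (λ J → J ∷ L ↭ _) H≡I₀ q))

<GM-∷ : ∀ {p} (J : Ideal p) {A B} → A ≡ B ⊎ A <GM B → J ∷ A ≡ J ∷ B ⊎ (J ∷ A) <GM (J ∷ B)
<GM-∷ J (inj₁ refl) = inj₁ refl
<GM-∷ J (inj₂ (inj₁ lt)) = inj₂ (inj₁ (ℕP.+-monoʳ-< (size J) lt))
<GM-∷ J (inj₂ (inj₂ (eq , lex))) = inj₂ (inj₂ (cong (size J +_) eq , inj₂ (refl , lex)))

module _ {p g : ℕ} (P : ColoredPoset p g) where
  open ColoredPoset P using (le; κ; linExt)

  infix 4 _⊑_ _⊏_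
  _⊑_ _⊏_ : Fin p → Fin p → Set
  _⊑_ = _≼_ P
  _⊏_ = _≺_ P

  OrderReversing : (Fin p → ℕ) → Set
  OrderReversing ψ = ∀ x y → x ⊑ y → ψ y ≤ ψ x

  OrderReversing-pred : ∀ {ψ} → OrderReversing ψ → OrderReversing (pred ∘ ψ)
  OrderReversing-pred rev x y x⊑y = ℕP.pred-mono-≤ (rev x y x⊑y)

  ⊏⇒∈prefix : ∀ {seen x z} → PrefixBefore seen x → z ⊏ x → z ∈ seen
  ⊏⇒∈prefix pre (z⊑x , z≢x) =
    PrefixBefore.complete pre (ℕP.≤∧≢⇒< (linExt _ _ z⊑x) (z≢x ∘ toℕ-injective))

  ⊑⇒∈prefix∷ʳ : ∀ {seen x y} → PrefixBefore seen x → y ⊑ x → y ∈ seen ∷ʳ x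
  ⊑⇒∈prefix∷ʳ {seen} {x} {y} pre y⊑x with y ≟F x
  ... | yes refl = ∈-∷ʳ-self seen x
  ... | no y≢x = ∈-++⁺ˡ (⊏⇒∈prefix pre (y⊑x , y≢x))

  record MinimalOutside (J : Ideal p) (a : Fin g) (y : Fin p) : Set where
    field
      outside  : lookup J y ≡ false
      coloured : κ y ≡ a
      lower∈   : ∀ {z} → z ⊏ y → z ∈I J

  isMinOutside-sound : ∀ {J a y} → isMinOutside P J a y ≡ true → MinimalOutside J a y
  isMinOutside-sound {J} {a} {y} e = record
    { outside  = not-injective (∧-trueˡ e)
    ; coloured = does⇒ (κ y ≟F a) (∧-trueˡ (∧-trueʳ {not (lookup J y)} e))
    ; lower∈   = lower∈
    }
    where
    lower∈ : ∀ {z} → z ⊏ y → z ∈I J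
    lower∈ {z} (z⊑y , z≢y)
      with ∨-true⁻ {not (le z y)}
             (allB-sound _ (allFin p) (∧-trueʳ {does (κ y ≟F a)} (∧-trueʳ {not (lookup J y)} e)) (∈-allFin z))
    ... | inj₁ z⋢y = ⊥-elim (≡true⇒≢false z⊑y (not-injective z⋢y))
    ... | inj₂ e′ with ∨-true⁻ {does (z ≟F y)} e′
    ...   | inj₁ z≡y = ⊥-elim (z≢y (does⇒ (z ≟F y) z≡y))
    ...   | inj₂ z∈J = z∈J

  isMinOutside-complete : ∀ {J a y} → MinimalOutside J a y → isMinOutside P J a y ≡ true
  isMinOutside-complete {J} {a} {y} min =
    ∧-true (cong not outside) (∧-true (dec-true (κ y ≟F a) coloured) (allB-complete _ (allFin p) λ {z} _ → lower z))
    where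
    open MinimalOutside min
    lower : ∀ z → (not (le z y) ∨ does (z ≟F y) ∨ lookup J z) ≡ true
    lower z with le z y in z⊑y
    ... | false = refl
    ... | true with z ≟F y
    ...   | yes _ = refl
    ...   | no z≢y = lower∈ (z⊑y , z≢y)

  lookup-addElem : ∀ J y z → lookup (addElem P J y) z ≡ does (z ≟F y) ∨ lookup J z
  lookup-addElem J y z = lookup∘tabulate _ z

  ∈-addElem⁻ : ∀ J y {z} → z ∈I addElem P J y → z ≡ y ⊎ z ∈I J
  ∈-addElem⁻ J y {z} z∈ with ∨-true⁻ {does (z ≟F y)} (trans (sym (lookup-addElem J y z)) z∈)
  ... | inj₁ z≡y = inj₁ (does⇒ (z ≟F y) z≡y)
  ... | inj₂ z∈J = inj₂ z∈J

  ∈-addElem-self : ∀ J y → y ∈I addElem P J y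
  ∈-addElem-self J y = trans (lookup-addElem J y y) (cong (_∨ lookup J y) (dec-true (y ≟F y) refl))

  ⊆-addElem : ∀ J y → J ⊆I addElem P J y
  ⊆-addElem J y z z∈J = trans (lookup-addElem J y z) (∨-trueʳ (does (z ≟F y)) z∈J)

  size-addElem : ∀ J y → lookup J y ≡ false → size (addElem P J y) ≡ suc (size J)
  size-addElem J y y∉J = size-insert J (addElem P J y) y y∉J (∈-addElem-self J y)
    (λ z z≢y → trans (lookup-addElem J y z) (cong (_∨ lookup J z) (dec-false (z ≟F y) z≢y)))

  addElem-isIdeal : ∀ {J a y} → IsIdeal P J → MinimalOutside J a y → IsIdeal P (addElem P J y)
  addElem-isIdeal {J} {y = y} J-ideal min u v u⊑v v∈ with ∈-addElem⁻ J y v∈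
  ... | inj₂ v∈J = ⊆-addElem J y u (J-ideal u v u⊑v v∈J)
  ... | inj₁ refl with u ≟F v
  ...   | yes refl = ∈-addElem-self J v
  ...   | no u≢v = ⊆-addElem J v u (MinimalOutside.lower∈ min (u⊑v , u≢v))

  ∈-Xideal⁻ : ∀ {a} J {J′} → J′ ∈ Xideal P a J → ∃ λ y → MinimalOutside J a y × J′ ≡ addElem P J y
  ∈-Xideal⁻ {a} J J′∈ with y , y∈ , refl ← ∈-map⁻ (addElem P J) J′∈ =
    y , isMinOutside-sound (proj₂ (∈-filter⁻ (λ x → isMinOutside P J a x ≟B true) {xs = allFin p} y∈)) , refl

  ∈-Xideal⁺ : ∀ {a J y} → MinimalOutside J a y → addElem P J y ∈ Xideal P a J
  ∈-Xideal⁺ {a} {J} {y} min = ∈-map⁺ (addElem P J)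
    (∈-filter⁺ (λ x → isMinOutside P J a x ≟B true) (∈-allFin y) (isMinOutside-complete min))

  XStep : Fin g → List (Ideal p) → List (Ideal p) → Set
  XStep a = StepAt (λ J J′ → J′ ∈ Xideal P a J)

  Reach : List (Fin p) → List (Ideal p) → List (Ideal p) → Set
  Reach = Run (λ x J J′ → J′ ∈ Xideal P (κ x) J)

  ∈-Xmulti⁻ : ∀ {a} L {L′} → L′ ∈ Xmulti P a L → XStep a L L′
  ∈-Xmulti⁻ {a} (J ∷ L) L′∈ with ∈-++⁻ (map (_∷ L) (Xideal P a J)) L′∈
  ... | inj₁ L′∈₁ with J′ , J′∈ , refl ← ∈-map⁻ (_∷ L) L′∈₁ = here J′∈
  ∈-Xmulti⁻ {a} (J ∷ L) L′∈ | inj₂ L′∈₂ with L₂ , L₂∈ , refl ← ∈-map⁻ (J ∷_) L′∈₂ =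
    there (∈-Xmulti⁻ L L₂∈)

  ∈-Xmulti⁺ : ∀ {a L L′} → XStep a L L′ → L′ ∈ Xmulti P a L
  ∈-Xmulti⁺ (here {xs = L} J′∈) = ∈-++⁺ˡ (∈-map⁺ (_∷ L) J′∈)
  ∈-Xmulti⁺ {a} (there {x = J} {xs = L} s) =
    ∈-++⁺ʳ (map (_∷ L) (Xideal P a J)) (∈-map⁺ (J ∷_) (∈-Xmulti⁺ s))

  XStep-totalSize : ∀ {a L L′} → XStep a L L′ → totalSize L′ ≡ suc (totalSize L)
  XStep-totalSize {a} (here {x = J} {xs = L} J′∈) with y , min , refl ← ∈-Xideal⁻ {a} J J′∈ =
    cong (_+ totalSize L) (size-addElem J y (MinimalOutside.outside min))
  XStep-totalSize (there {x = J} s) = trans (cong (size J +_) (XStep-totalSize s)) (ℕP.+-suc (size J) _)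

  Reach-totalSize : ∀ {w L L′} → Reach w L L′ → totalSize L′ ≡ length w + totalSize L
  Reach-totalSize [] = refl
  Reach-totalSize (s ∷ r) = trans (Reach-totalSize r) (trans (cong (_ +_) (XStep-totalSize s)) (ℕP.+-suc _ _))

  Reach-↭ : ∀ {w m L M} → Reach w (emptyMulti p m) L → L ↭ M → Reach w (emptyMulti p m) M
  Reach-↭ {m = m} r L↭M with S , E↭S , r′ ← ↭-Run r L↭M =
    subst (λ S → Reach _ S _) (↭-replicate⁻ m E↭S) r′

  ∈-Xvec⁻ : ∀ {a} v {c L′} → (c , L′) ∈ Xvec P a v → ∃ λ L → (c , L) ∈ v × L′ ∈ Xmulti P a L
  ∈-Xvec⁻ {a} ((c₀ , L₀) ∷ v) t∈ with ∈-++⁻ (map (c₀ ,_) (Xmulti P a L₀)) t∈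
  ... | inj₁ t∈₁ with L₁ , L₁∈ , refl ← ∈-map⁻ (c₀ ,_) t∈₁ = L₀ , here refl , L₁∈
  ∈-Xvec⁻ {a} ((c₀ , L₀) ∷ v) t∈ | inj₂ t∈₂ with L , t∈v , L′∈ ← ∈-Xvec⁻ v t∈₂ =
    L , there t∈v , L′∈

  ∈-Xvec⁺ : ∀ {a} v {c L L′} → (c , L) ∈ v → L′ ∈ Xmulti P a L → (c , L′) ∈ Xvec P a v
  ∈-Xvec⁺ ((c₀ , L₀) ∷ v) (here refl) L′∈ = ∈-++⁺ˡ (∈-map⁺ (c₀ ,_) L′∈)
  ∈-Xvec⁺ {a} ((c₀ , L₀) ∷ v) (there t∈v) L′∈ =
    ∈-++⁺ʳ (map (c₀ ,_) (Xmulti P a L₀)) (∈-Xvec⁺ v t∈v L′∈)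

  Xpow-suc : ∀ a k v → Xpow P a (suc k) v ≡ Xpow P a k (Xvec P a v)
  Xpow-suc a zero v = refl
  Xpow-suc a (suc k) v = cong (Xvec P a) (Xpow-suc a k v)

  ∈-Xpow⁻ : ∀ x k v {c L′} → (c , L′) ∈ Xpow P (κ x) k v →
    ∃ λ L → (c , L) ∈ v × Reach (replicate k x) L L′
  ∈-Xpow⁻ x zero v t∈ = _ , t∈ , []
  ∈-Xpow⁻ x (suc k) v t∈ with ∈-Xpow⁻ x k (Xvec P (κ x) v) (subst (_ ∈_) (Xpow-suc (κ x) k v) t∈)
  ... | L₁ , t₁∈ , r with ∈-Xvec⁻ v t₁∈
  ...   | L , t∈v , L₁∈ = L , t∈v , ∈-Xmulti⁻ L L₁∈ ∷ r

  ∈-Xpow⁺ : ∀ x k v {c L L′} → (c , L) ∈ v → Reach (replicate k x) L L′ → (c , L′) ∈ Xpow P (κ x) k v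
  ∈-Xpow⁺ x zero v t∈ [] = t∈
  ∈-Xpow⁺ x (suc k) v t∈ (s ∷ r) =
    subst (_ ∈_) (sym (Xpow-suc (κ x) k v)) (∈-Xpow⁺ x k (Xvec P (κ x) v) (∈-Xvec⁺ v t∈ (∈-Xmulti⁺ s)) r)

  ∈-scale⁻ : ∀ q v {c L} → (c , L) ∈ scale P q v → ∃ λ c₀ → c ≡ q *ℚ c₀ × (c₀ , L) ∈ v
  ∈-scale⁻ q ((c₀ , L₀) ∷ v) (here refl) = c₀ , refl , here refl
  ∈-scale⁻ q (_ ∷ v) (there t∈) with c₀ , eq , t∈v ← ∈-scale⁻ q v t∈ = c₀ , eq , there t∈v

  ∈-scale⁺ : ∀ q v {c L} → (c , L) ∈ v → (q *ℚ c , L) ∈ scale P q v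
  ∈-scale⁺ q (_ ∷ v) (here refl) = here refl
  ∈-scale⁺ q (_ ∷ v) (there t∈) = there (∈-scale⁺ q v t∈)

  1/k! : ℕ → ℚ
  1/k! k = (ℤ+ 1 / (k !)) {{k !≢0}}

  AllPositive-divPow : ∀ x k {v} → AllPositive v → AllPositive (divPow P (κ x) k v)
  AllPositive-divPow x k {v} pos t∈ with c₀ , refl , t₀∈ ← ∈-scale⁻ (1/k! k) _ t∈ with ∈-Xpow⁻ x k v t₀∈
  ... | _ , t∈v , _ = pos*pos⇒pos (1/k! k) {{normalize-pos 1 (k !) {{k !≢0}}}} c₀ {{pos t∈v}}

  ∈-divPow⁻ : ∀ x k v {c L′} → (c , L′) ∈ divPow P (κ x) k v →
    ∃₂ λ c₀ L → (c₀ , L) ∈ v × Reach (replicate k x) L L′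
  ∈-divPow⁻ x k v t∈
    with c₀ , _ , t₀∈ ← ∈-scale⁻ (1/k! k) _ t∈
    with L , t∈v , r ← ∈-Xpow⁻ x k v t₀∈ = c₀ , L , t∈v , r

  ∈-divPow⁺ : ∀ x k v {c₀ L L′} → (c₀ , L) ∈ v → Reach (replicate k x) L L′ →
    ∃ λ c → (c , L′) ∈ divPow P (κ x) k v
  ∈-divPow⁺ x k v t∈ r = _ , ∈-scale⁺ (1/k! k) _ (∈-Xpow⁺ x k v t∈ r)

  module _ (ψ : Fin p → ℕ) where

    applyFrom : List (Fin p) → MVec p → MVec p
    applyFrom xs v = foldl (λ w x → divPow P (κ x) (ψ x) w) v xs

    AllPositive-applyFrom : ∀ xs {v} → AllPositive v → AllPositive (applyFrom xs v)
    AllPositive-applyFrom [] pos = pos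
    AllPositive-applyFrom (x ∷ xs) pos = AllPositive-applyFrom xs (AllPositive-divPow x (ψ x) pos)

    ∈-applyFrom⁻ : ∀ xs v {c L′} → (c , L′) ∈ applyFrom xs v →
      ∃₂ λ c₀ L → (c₀ , L) ∈ v × Reach (word ψ xs) L L′
    ∈-applyFrom⁻ [] v t∈ = _ , _ , t∈ , []
    ∈-applyFrom⁻ (x ∷ xs) v t∈
      with _ , L₁ , t₁∈ , r₁ ← ∈-applyFrom⁻ xs _ t∈
      with c₀ , L , t∈v , r ← ∈-divPow⁻ x (ψ x) v t₁∈ = c₀ , L , t∈v , Run-++ r r₁

    ∈-applyFrom⁺ : ∀ xs v {c₀ L L′} → (c₀ , L) ∈ v → Reach (word ψ xs) L L′ →
      ∃ λ c → (c , L′) ∈ applyFrom xs v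
    ∈-applyFrom⁺ [] v t∈ [] = _ , t∈
    ∈-applyFrom⁺ (x ∷ xs) v t∈ r
      with _ , r₁ , r₂ ← Run-++⁻ (replicate (ψ x) x) r
      with _ , t₁∈ ← ∈-divPow⁺ x (ψ x) v t∈ r₁ = ∈-applyFrom⁺ xs _ t₁∈ r₂

    AllPositive-applyWord : ∀ m → AllPositive (applyWord P ψ [ (1ℚ , emptyMulti p m) ])
    AllPositive-applyWord m = AllPositive-applyFrom (allFin p) λ { (here refl) → _ }

    ∈-applyWord⁻ : ∀ m {c L} → (c , L) ∈ applyWord P ψ [ (1ℚ , emptyMulti p m) ] →
      Reach (word ψ (allFin p)) (emptyMulti p m) L
    ∈-applyWord⁻ m t∈ with _ , _ , here refl , r ← ∈-applyFrom⁻ (allFin p) _ t∈ = r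

    ∈-applyWord⁺ : ∀ m {L} → Reach (word ψ (allFin p)) (emptyMulti p m) L →
      ∃ λ c → (c , L) ∈ applyWord P ψ [ (1ℚ , emptyMulti p m) ]
    ∈-applyWord⁺ m = ∈-applyFrom⁺ (allFin p) _ (here refl)

  record SupportedIdeal (ψ : Fin p → ℕ) (seen : List (Fin p)) (J : Ideal p) : Set where
    constructor supported
    field
      isIdeal  : IsIdeal P J
      ⊆Support : ∀ y → y ∈I J → Support ψ seen y

  SupportedIdeal-∷ʳ : ∀ {ψ seen x J} → SupportedIdeal ψ seen J → SupportedIdeal ψ (seen ∷ʳ x) J
  SupportedIdeal-∷ʳ (supported J-ideal J⊆) = supported J-ideal (λ y → Support-∷ʳ ∘ J⊆ y)

  emptyMulti-supported : ∀ {ψ seen} m → All (SupportedIdeal ψ seen) (emptyMulti p m)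
  emptyMulti-supported m =
    replicate⁺ m (supported (λ _ y _ y∈∅ → ⊥-elim (∉∅ y y∈∅)) (λ y y∈∅ → ⊥-elim (∉∅ y y∈∅)))

  level-minimal : ∀ {ψ seen x J} → OrderReversing ψ → PrefixBefore seen x → 1 ≤ ψ x → IsLevel ψ seen J →
    MinimalOutside J (κ x) x
  level-minimal {x = x} rev pre ψx≥1 (level J⊆ ⊆J) = record
    { outside  = ¬-not (prefix-∌ pre ∘ Support.∈seen ∘ J⊆ x)
    ; coloured = refl
    ; lower∈   = λ {z} z⊏x → ⊆J z (support (⊏⇒∈prefix pre z⊏x) (ℕP.≤-trans ψx≥1 (rev z x (proj₁ z⊏x))))
    }

  IsLevel-∷ʳ-addElem : ∀ {ψ seen x J} → 1 ≤ ψ x → IsLevel ψ seen J → IsLevel ψ (seen ∷ʳ x) (addElem P J x)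
  IsLevel-∷ʳ-addElem {ψ} {seen} {x} {J} ψx≥1 (level J⊆ ⊆J) = level ⊆S S⊆
    where
    ⊆S : ∀ y → y ∈I addElem P J x → Support ψ (seen ∷ʳ x) y
    ⊆S y y∈ with ∈-addElem⁻ J x y∈
    ... | inj₁ refl = support (∈-∷ʳ-self seen x) ψx≥1
    ... | inj₂ y∈J = Support-∷ʳ (J⊆ y y∈J)
    S⊆ : ∀ y → Support ψ (seen ∷ʳ x) y → y ∈I addElem P J x
    S⊆ y (support y∈ ψy≥1) with ∈-∷ʳ⁻ seen y∈
    ... | inj₁ y∈seen = ⊆-addElem J x y (⊆J y (support y∈seen ψy≥1))
    ... | inj₂ refl = ∈-addElem-self J x

  extend-flag : ∀ {ψ seen x} L → OrderReversing ψ → PrefixBefore seen x → IsFlag ψ seen L → ψ x ≤ length L →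
    ∃ λ L′ → Reach (replicate (ψ x) x) L L′ × IsFlag ψ (seen ∷ʳ x) L′
  extend-flag {ψ} {seen} {x} L rev pre L-flag ψx≤ with ψ x in ψx≡
  ... | zero = L , [] , IsFlag-∷ʳ-zero L ψx≡ L-flag
  extend-flag {ψ} {seen} {x} (J ∷ L) rev pre (J-level , L-flag) (s≤s n≤) | suc n
    with L′ , r , L′-flag ← extend-flag L (OrderReversing-pred rev) pre L-flag
                                        (subst (_≤ length L) (sym (cong pred ψx≡)) n≤) =
    addElem P J x ∷ L′ ,
    here (∈-Xideal⁺ (level-minimal rev pre ψx≥1 J-level)) ∷
      Run-there (subst (λ k → Reach (replicate k x) L L′) (cong pred ψx≡) r) ,
    IsLevel-∷ʳ-addElem ψx≥1 J-level , L′-flag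
    where
    ψx≥1 : 1 ≤ ψ x
    ψx≥1 = subst (1 ≤_) (sym ψx≡) (s≤s z≤n)

  flag-reachable : ∀ {ψ} m → OrderReversing ψ → (∀ x → ψ x ≤ m) →
    ∃ λ L → Reach (word ψ (allFin p)) (emptyMulti p m) L × IsFlag ψ (allFin p) L
  flag-reachable {ψ} m rev ψ≤m = allFin-∷ʳ-induction Reachable (emptyMulti p m , [] , IsFlag-empty m ψ) extend
    where
    Reachable : List (Fin p) → Set
    Reachable seen = ∃ λ L → Reach (word ψ seen) (emptyMulti p m) L × IsFlag ψ seen L
    extend : ∀ seen x → PrefixBefore seen x → Reachable seen → Reachable (seen ∷ʳ x)
    extend seen x pre (L , r , L-flag)
      with L′ , r′ , L′-flag ← extend-flag L rev pre L-flag
                                 (subst (ψ x ≤_) (trans (sym (length-replicate m)) (sym (Run-length r))) (ψ≤m x)) =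
      L′ , subst (λ w → Reach w _ L′) (sym (word-∷ʳ ψ seen x)) (Run-++ r r′) , L′-flag

  module _ (ec : EC P) (nd : ND P) where

    ⊏-between : ∀ {u v} → κ u ≡ κ v → u ⊏ v → ∃ λ z → u ⊏ z × z ⊏ v
    ⊏-between {u} {v} κu≡κv u⊏v =
      let z , ¬¬between = ¬∀⟶∃¬ p _ (λ z → ¬? (between? z)) (λ none → nd u v (u⊏v , none) κu≡κv)
      in z , decidable-stable (between? z) ¬¬between
      where
      _⊏?_ : ∀ x y → Dec (x ⊏ y)
      x ⊏? y = (le x y ≟B true) ×-dec ¬? (x ≟F y)
      between? : ∀ z → Dec (u ⊏ z × z ⊏ v)
      between? z = (u ⊏? z) ×-dec (z ⊏? v)

    Xideal-twice : ∀ {a} J {J₁ J₂} → IsIdeal P J → J₁ ∈ Xideal P a J → ¬ (J₂ ∈ Xideal P a J₁)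
    Xideal-twice {a} J J-ideal J₁∈ J₂∈ with ∈-Xideal⁻ J J₁∈
    ... | y , y-min , refl with ∈-Xideal⁻ (addElem P J y) J₂∈
    ...   | y′ , y′-min , _ = absurd
      where
      module Y = MinimalOutside y-min
      module Y′ = MinimalOutside y′-min
      y′≢y : y′ ≢ y
      y′≢y refl = ≡true⇒≢false (∈-addElem-self J y) Y′.outside
      y′∉J : ¬ (y′ ∈I J)
      y′∉J y′∈J = ≡true⇒≢false (⊆-addElem J y y′ y′∈J) Y′.outside
      κy≡κy′ : κ y ≡ κ y′
      κy≡κy′ = trans Y.coloured (sym Y′.coloured)
      absurd : ⊥
      absurd with ec y y′ κy≡κy′
      ... | inj₂ y′⊑y = y′∉J (Y.lower∈ (y′⊑y , y′≢y))
      ... | inj₁ y⊑y′ with z , (y⊑z , y≢z) , z⊏y′ ← ⊏-between κy≡κy′ (y⊑y′ , y′≢y ∘ sym)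
                      with ∈-addElem⁻ J y (Y′.lower∈ z⊏y′)
      ...   | inj₁ z≡y = y≢z (sym z≡y)
      ...   | inj₂ z∈J = ≡true⇒≢false (J-ideal y z y⊑z z∈J) Y.outside

    head-frozen : ∀ {x n} J₀ {J₁ R₀ J R} → IsIdeal P J₀ → J₁ ∈ Xideal P (κ x) J₀ →
      Reach (replicate n x) (J₁ ∷ R₀) (J ∷ R) → J ≡ J₁ × Reach (replicate n x) R₀ R
    head-frozen {n = zero} _ _ _ [] = refl , []
    head-frozen {n = suc n} J₀ J₀-ideal J₁∈ (here J₂∈ ∷ r) = ⊥-elim (Xideal-twice J₀ J₀-ideal J₁∈ J₂∈)
    head-frozen {n = suc n} J₀ J₀-ideal J₁∈ (there s ∷ r) with J≡J₁ , r′ ← head-frozen J₀ J₀-ideal J₁∈ r =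
      J≡J₁ , s ∷ r′

    head-in-block : ∀ {x} n {J₀ R₀ J R} → IsIdeal P J₀ → Reach (replicate n x) (J₀ ∷ R₀) (J ∷ R) →
      (J ≡ J₀ × Reach (replicate n x) R₀ R) ⊎
      (∃ λ n′ → n ≡ suc n′ × J ∈ Xideal P (κ x) J₀ × Reach (replicate n′ x) R₀ R)
    head-in-block zero _ [] = inj₁ (refl , [])
    head-in-block (suc n) {J₀} J₀-ideal (here J₁∈ ∷ r) with refl , r′ ← head-frozen J₀ J₀-ideal J₁∈ r =
      inj₂ (n , refl , J₁∈ , r′)
    head-in-block (suc n) J₀-ideal (there s ∷ r) with head-in-block n J₀-ideal r
    ... | inj₁ (refl , r′) = inj₁ (refl , s ∷ r′)
    ... | inj₂ (n′ , refl , J∈ , r′) = inj₂ (suc n′ , refl , J∈ , s ∷ r′)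

    minimal-⊑ : ∀ {seen x J y} → PrefixBefore seen x → (∀ z → z ∈I J → z ∈ seen ∷ʳ x) →
      MinimalOutside J (κ x) y → y ⊑ x
    minimal-⊑ {seen} {x} {J} {y} pre J⊆ y-min with y ≟F x
    ... | yes refl = ColoredPoset.refl P y
    ... | no y≢x with ec y x (MinimalOutside.coloured y-min)
    ...   | inj₁ y⊑x = y⊑x
    ...   | inj₂ x⊑y = ⊥-elim (above (⊏-between (sym (MinimalOutside.coloured y-min)) (x⊑y , y≢x ∘ sym)))
      where
      above : ¬ (∃ λ z → x ⊏ z × z ⊏ y)
      above (z , (x⊑z , x≢z) , z⊏y) with ∈-∷ʳ⁻ seen (J⊆ z (MinimalOutside.lower∈ y-min z⊏y))
      ... | inj₁ z∈seen = ℕP.<⇒≱ (PrefixBefore.below pre z∈seen) (linExt x z x⊑z)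
      ... | inj₂ z≡x = x≢z (sym z≡x)

    supported-addElem : ∀ {ψ seen x J y} → OrderReversing ψ → PrefixBefore seen x → 1 ≤ ψ x →
      SupportedIdeal ψ (seen ∷ʳ x) J → MinimalOutside J (κ x) y → SupportedIdeal ψ (seen ∷ʳ x) (addElem P J y)
    supported-addElem {ψ} {seen} {x} {J} {y} rev pre ψx≥1 (supported J-ideal J⊆) y-min =
      supported (addElem-isIdeal J-ideal y-min) ⊆S
      where
      y⊑x : y ⊑ x
      y⊑x = minimal-⊑ pre (λ z → Support.∈seen ∘ J⊆ z) y-min
      ⊆S : ∀ z → z ∈I addElem P J y → Support ψ (seen ∷ʳ x) z
      ⊆S z z∈ with ∈-addElem⁻ J y z∈
      ... | inj₁ refl = support (⊑⇒∈prefix∷ʳ pre y⊑x) (ℕP.≤-trans ψx≥1 (rev y x y⊑x))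
      ... | inj₂ z∈J = J⊆ z z∈J

    supported-replicate : ∀ {ψ seen x} n {L L′} → OrderReversing ψ → PrefixBefore seen x → n ≤ ψ x →
      Reach (replicate n x) L L′ → All (SupportedIdeal ψ (seen ∷ʳ x)) L → All (SupportedIdeal ψ (seen ∷ʳ x)) L′
    supported-replicate zero _ _ _ [] sL = sL
    supported-replicate {ψ} {seen} {x} (suc n) rev pre n<ψx (s ∷ r) sL =
      supported-replicate n rev pre (ℕP.<⇒≤ n<ψx) r (supported-step s sL)
      where
      supported-step : ∀ {L L′} → XStep (κ x) L L′ →
        All (SupportedIdeal ψ (seen ∷ʳ x)) L → All (SupportedIdeal ψ (seen ∷ʳ x)) L′
      supported-step (here {x = J} J′∈) (sJ ∷ sL) with y , y-min , refl ← ∈-Xideal⁻ J J′∈ =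
        supported-addElem rev pre (ℕP.≤-trans (s≤s z≤n) n<ψx) sJ y-min ∷ sL
      supported-step (there s) (sJ ∷ sL) = sJ ∷ supported-step s sL

    module _ {ψ : Fin p → ℕ} (rev : OrderReversing ψ) where

      peel-head : ∀ {seen x J₀ R₀ J R} → PrefixBefore seen x → SupportedIdeal ψ seen J₀ →
        IsLevel ψ (seen ∷ʳ x) J → Reach (replicate (ψ x) x) (J₀ ∷ R₀) (J ∷ R) →
        IsLevel ψ seen J₀ × Reach (replicate (pred (ψ x)) x) R₀ R
      peel-head {seen} {x} {J₀} {R₀} {J} {R} pre (supported J₀-ideal J₀⊆) J-level r =
        peel (head-in-block (ψ x) J₀-ideal r)
        where
        x∈J : 1 ≤ ψ x → x ∈I J
        x∈J = IsLevel.Support⊆ J-level x ∘ support (∈-∷ʳ-self seen x)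
        x∉J₀ : ¬ (x ∈I J₀)
        x∉J₀ = prefix-∌ pre ∘ Support.∈seen ∘ J₀⊆ x
        level₀ : (∀ z → z ∈I J → z ≡ x ⊎ z ∈I J₀) → IsLevel ψ seen J₀
        level₀ = IsLevel-∷ʳ⁻ pre J-level J₀⊆
        peel : (J ≡ J₀ × Reach (replicate (ψ x) x) R₀ R) ⊎
               (∃ λ n′ → ψ x ≡ suc n′ × J ∈ Xideal P (κ x) J₀ × Reach (replicate n′ x) R₀ R) →
               IsLevel ψ seen J₀ × Reach (replicate (pred (ψ x)) x) R₀ R
        peel (inj₁ (J≡J₀ , r′)) =
          level₀ (λ z z∈J → inj₂ (subst (z ∈I_) J≡J₀ z∈J)) ,
          subst (λ k → Reach (replicate k x) R₀ R) (trans ψx≡0 (cong pred (sym ψx≡0))) r′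
          where
          ψx≡0 : ψ x ≡ 0
          ψx≡0 = ℕP.n<1⇒n≡0 (ℕP.≰⇒> (x∉J₀ ∘ subst (x ∈I_) J≡J₀ ∘ x∈J))
        peel (inj₂ (n′ , ψx≡ , J∈ , r′)) with y , _ , J≡ ← ∈-Xideal⁻ J₀ J∈ =
          level₀ J⊆x∪J₀ , subst (λ k → Reach (replicate k x) R₀ R) (cong pred (sym ψx≡)) r′
          where
          ∈J⇒ : ∀ {z} → z ∈I J → z ≡ y ⊎ z ∈I J₀
          ∈J⇒ {z} = ∈-addElem⁻ J₀ y ∘ subst (z ∈I_) J≡
          y≡x : y ≡ x
          y≡x with ∈J⇒ (x∈J (subst (1 ≤_) (sym ψx≡) (s≤s z≤n)))
          ... | inj₁ x≡y = sym x≡y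
          ... | inj₂ x∈J₀ = ⊥-elim (x∉J₀ x∈J₀)
          J⊆x∪J₀ : ∀ z → z ∈I J → z ≡ x ⊎ z ∈I J₀
          J⊆x∪J₀ z z∈J with ∈J⇒ z∈J
          ... | inj₁ z≡y = inj₁ (trans z≡y y≡x)
          ... | inj₂ z∈J₀ = inj₂ z∈J₀

      ReachSupported : List (Fin p) → Set
      ReachSupported seen = ∀ {m L} → Reach (word ψ seen) (emptyMulti p m) L → All (SupportedIdeal ψ seen) L

      Peelable : List (Fin p) → Set
      Peelable seen = ∀ {m J R} → IsLevel ψ seen J → Reach (word ψ seen) (emptyMulti p (suc m)) (J ∷ R) →
        Reach (word (pred ∘ ψ) seen) (emptyMulti p m) R

      reachSupported-∷ʳ : ∀ {seen x} → PrefixBefore seen x → ReachSupported seen → ReachSupported (seen ∷ʳ x)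
      reachSupported-∷ʳ {seen} {x} pre reachSupported r
        with _ , r₀ , r₁ ← Run-++⁻ (word ψ seen) (subst (λ w → Reach w _ _) (word-∷ʳ ψ seen x) r) =
        supported-replicate (ψ x) rev pre ℕP.≤-refl r₁ (All.map SupportedIdeal-∷ʳ (reachSupported r₀))

      peelable-∷ʳ : ∀ {seen x} → PrefixBefore seen x → ReachSupported seen → Peelable seen → Peelable (seen ∷ʳ x)
      peelable-∷ʳ {seen} {x} pre reachSupported peelable {m} {J} {R} J-level r
        with Run-++⁻ (word ψ seen) (subst (λ w → Reach w _ _) (word-∷ʳ ψ seen x) r)
      ... | [] , _ , r₁ = ⊥-elim (ℕP.1+n≢0 (Run-length r₁))
      ... | J₀ ∷ R₀ , r₀ , r₁
        with J₀-supp ∷ _ ← reachSupported r₀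
        with J₀-level , r′ ← peel-head pre J₀-supp J-level r₁ =
        subst (λ w → Reach w _ R) (sym (word-∷ʳ (pred ∘ ψ) seen x)) (Run-++ (peelable J₀-level r₀) r′)

      reachSupported×peelable : ReachSupported (allFin p) × Peelable (allFin p)
      reachSupported×peelable = allFin-∷ʳ-induction (λ seen → ReachSupported seen × Peelable seen)
        ((λ { {m} [] → emptyMulti-supported m }) , (λ { _ [] → [] }))
        (λ seen x pre (supp , peel) → reachSupported-∷ʳ pre supp , peelable-∷ʳ pre supp peel)

    flag-gravity-minimal : ∀ m {ψ} → OrderReversing ψ → {I : Fin m → Ideal p} → FlagOf I ψ →
      ∀ {M} → Reach (word ψ (allFin p)) (emptyMulti p m) M → SortedG M → totalSize (tabulate I) ≡ totalSize M →
      tabulate I ≡ M ⊎ tabulate I <GM M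
    flag-gravity-minimal zero _ _ {[]} _ _ _ = inj₁ refl
    flag-gravity-minimal zero _ _ {_ ∷ _} r _ _ = ⊥-elim (ℕP.1+n≢0 (Run-length r))
    flag-gravity-minimal (suc m) _ _ {[]} r _ _ = ⊥-elim (ℕP.1+n≢0 (sym (Run-length r)))
    flag-gravity-minimal (suc m) {ψ} rev {I} flag {J ∷ M} r sM tot with ≡-dec _≟B_ J (I F.zero)
    ... | yes refl =
      <GM-∷ J (flag-gravity-minimal m (OrderReversing-pred rev) (FlagOf-tail flag)
                 (proj₂ (reachSupported×peelable rev) (IsLevel-head flag) r)
                 (SortedG-tail sM) (ℕP.+-cancelˡ-≡ (size J) _ _ tot))
    ... | no J≢I₀ = inj₂ (inj₂ (tot , inj₁ (inj₁ (⊂⇒size< J (I F.zero) J⊆I₀ J≢I₀))))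
      where
      J-supported : SupportedIdeal ψ (allFin p) J
      J-supported = All.head (proj₁ (reachSupported×peelable rev) r)
      J⊆I₀ : J ⊆I I F.zero
      J⊆I₀ y =
        Equivalence.from (FlagOf.∈⇔ flag F.zero y) ∘ Support.positive ∘ SupportedIdeal.⊆Support J-supported y

lemma4p4 : (p g m : ℕ) → 1 ≤ p → 1 ≤ m → (P : ColoredPoset p g) →
    Surjective-κ P → EC P → ND P → Connected P →
    (I : Fin m → Ideal p) → (∀ k → IsIdeal P (I k)) →
    (∀ k l → toℕ k ≤ toℕ l → ∀ x → x ∈I I l → x ∈I I k) →
    (ψ : Fin p → ℕ) → (∀ x → ψ x ≤ m) →
    (∀ x y → ColoredPoset.le P x y ≡ true → ψ y ≤ ψ x) →
    (∀ (k : Fin m) x → (x ∈I I k) ⇔ (suc (toℕ k) ≤ ψ x)) →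
    IsLeadingMultiset (applyWord P ψ [ (1ℚ , emptyMulti p m) ])
      (map I (allFin m))
lemma4p4 p g m _ _ P _ ec nd _ I _ _ ψ ψ≤m rev ∈⇔ =
  subst (IsLeadingMultiset v) (sym (map-tabulate id I))
    (IsLeadingMultiset-intro v (AllPositive-applyWord P ψ m) (proj₂ (∈-applyWord⁺ P ψ m flag-reach)) minimal)
  where
  flag : FlagOf I ψ
  flag = flagOf ∈⇔
  v : MVec p
  v = applyWord P ψ [ (1ℚ , emptyMulti p m) ]
  flag-reach : Reach P (word ψ (allFin p)) (emptyMulti p m) (tabulate I)
  flag-reach with L , r , L-flag ← flag-reachable P m rev ψ≤m =
    subst (Reach P _ _) (IsFlag⇒≡tabulate flag L-flag (trans (Run-length r) (length-replicate m))) r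
  minimal : ∀ L′ M → tabulate I ↭ L′ → SortedG L′ → SortedG M → ∀ {c K} → (c , K) ∈ v → K ↭ M →
    L′ ≡ M ⊎ L′ <GM M
  minimal L′ M I↭L′ sL′ sM t∈v K↭M with refl ← SortedG-flag-unique flag sL′ (↭-sym I↭L′) =
    flag-gravity-minimal P ec nd m rev flag M-reach sM
      (trans (Reach-totalSize P flag-reach) (sym (Reach-totalSize P M-reach)))
    where
    M-reach : Reach P (word ψ (allFin p)) (emptyMulti p m) M
    M-reach = Reach-↭ P (∈-applyWord⁻ P ψ m t∈v) K↭M
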